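{- Let $G=(V,E,w,l)$ be an Eulerian directed graph with $n=|V|$ vertices, positive weights $w$ and positive lengths $l$, and let $0<x_L<x_R$. Let $G'=(V',E',w',l')$ be $G$ collapsed to $[x_L,x_R]$. Then $$\mathrm{vol}(G')\le 2\sum_{e\in E:\ l(e)>x_L/n} w(e)\min(l(e),x_R).$$
   Context: A weighted directed graph is Eulerian if at each vertex the total weight of incoming arcs equals that of outgoing arcs. $G$ collapsed to $[x_L,x_R]$ is obtained by (i) merging (contracting into single vertices) any vertices that can reach each other while following only arcs of length at most $x_L$, with arcs whose endpoints are merged together being removed and all other arcs keeping their weights, and (ii) reducing the length of every arc longer than $x_R$ to $x_R$. $\mathrm{vol}(H)=\sum_{e}l(e)w(e)$.
   Formalization: The weights w and lengths l take values in the positive rationals rather than the positive reals, and the thresholds $x_L$, $x_R$ are rational. -}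

module Defs where

open import Data.Nat using (ℕ)
open import Data.Integer using (+_)
open import Data.Fin using (Fin)
open import Data.List using (List; []; _∷_; map; filter)
open import Data.List.Membership.Propositional using (_∈_)
open import Data.Product using (_×_)
open import Relation.Binary.PropositionalEquality using (_≡_)
open import Relation.Nullary using (Dec; ¬_; ¬?)
open import Data.Fin.Properties using (_≟_)
open import Data.Rational using (ℚ; 0ℚ; _+_; _*_; _≤_; _<_; _⊓_; _/_)
import Data.Rational.Properties as ℚP

record Arc (n : ℕ) : Set where
  constructor arc
  field
    src : Fin n
    tgt : Fin n
    w   : ℚ
    l   : ℚ
open Arc public

record Graph : Set where
  constructor graph
  field
    n    : ℕ
    arcs : List (Arc n)
open Graph public

sumℚ : List ℚ → ℚ
sumℚ []       = 0ℚ
sumℚ (x ∷ xs) = x + sumℚ xs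

PositiveWL : Graph → Set
PositiveWL G = ∀ {e} → e ∈ arcs G → (0ℚ < w e) × (0ℚ < l e)

inWeight : (G : Graph) → Fin (n G) → ℚ
inWeight G v = sumℚ (map w (filter (λ e → tgt e ≟ v) (arcs G)))

outWeight : (G : Graph) → Fin (n G) → ℚ
outWeight G v = sumℚ (map w (filter (λ e → src e ≟ v) (arcs G)))

Eulerian : Graph → Set
Eulerian G = ∀ (v : Fin (n G)) → inWeight G v ≡ outWeight G v

data ShortReach (G : Graph) (xL : ℚ) : Fin (n G) → Fin (n G) → Set where
  here : ∀ {u} → ShortReach G xL u u
  step : ∀ {u v} (e : Arc (n G)) → e ∈ arcs G → l e ≤ xL → src e ≡ u →
         ShortReach G xL (tgt e) v → ShortReach G xL u v

Merged : (G : Graph) (xL : ℚ) → Fin (n G) → Fin (n G) → Set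
Merged G xL u v = ShortReach G xL u v × ShortReach G xL v u

vol : ∀ {m} → List (Arc m) → ℚ
vol es = sumℚ (map (λ e → l e * w e) es)

-- Vertices of G' are the merged classes; an arc is kept with the same weight
-- and its endpoints replaced by their classes, which does not affect vol.
collapsedArcs : (G : Graph) (xL xR : ℚ) →
                (dec : ∀ u v → Dec (Merged G xL u v)) → List (Arc (n G))
collapsedArcs G xL xR dec =
  map (λ e → arc (src e) (tgt e) (w e) (l e ⊓ xR))
      (filter (λ e → ¬? (dec (src e) (tgt e))) (arcs G))

-- The right-hand side: 2 Σ_{e : l(e) > xL/n} w(e) min(l(e), xR).
-- (n ≥ 1 whenever there is an arc; we write l(e) > xL/n as xL < l(e) * n.)
nℚ : ℕ → ℚ
nℚ k = (+ k) / 1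

rhsSum : (G : Graph) (xL xR : ℚ) → ℚ
rhsSum G xL xR =
  sumℚ (map (λ e → w e * (l e ⊓ xR))
            (filter (λ e → xL ℚP.<? (l e * nℚ (n G))) (arcs G)))

{-# OPTIONS --safe #-}

-- Surviving arcs with l(e) > xL/n are bounded termwise by the right-hand sum.
-- A surviving arc e with l(e) ≤ xL/n is short, and as its endpoints are not
-- merged, its tail is not short-reachable from its head; so e enters the set
-- R(v) of vertices short-reachable from v = tgt e. In an Eulerian graph the
-- weight entering R(v) equals the weight leaving it, and every arc leaving R(v)
-- is long (l > xL). Summing over the n vertices v, these arcs weigh at most
-- n·W, W being the weight of long arcs, so their volume is at most
-- (xL/n)·n·W = xL·W. Long arcs are counted on the right and have
-- min(l, xR) ≥ xL, so xL·W is again at most the right-hand sum.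

module Submission where

open import Defs
open import Algebra.Bundles using (CommutativeMonoid; CommutativeRing)
open import Data.Bool using (true; false; if_then_else_)
open import Data.Fin using (Fin; zero; suc; punchIn)
open import Data.Fin.Properties using (_≟_; punchInᵢ≢i; sequence)
open import Data.Integer as ℤ using (+_)
import Data.Integer.Properties as ℤP
open import Data.List using (List; []; _∷_; map; filter)
open import Data.List.Membership.Propositional using (_∈_)
open import Data.List.Properties using (map-∘)
open import Data.List.Relation.Unary.Any using (here; there)
open import Data.Nat using (zero; suc)
open import Data.Product using (_×_; _,_; proj₁; proj₂)
open import Data.Rational
  using (ℚ; 0ℚ; 1ℚ; _+_; _*_; _≤_; _<_; _/_; _⊓_; toℚᵘ; nonNegative)
import Data.Rational.Properties as ℚP
import Data.Rational.Unnormalised as ℚᵘ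
import Data.Rational.Unnormalised.Properties as ℚᵘP
open import Effect.Monad using (RawMonad)
open import Function using (_∘_; id)
open import Relation.Binary.PropositionalEquality
  using (_≡_; _≢_; refl; sym; trans; cong; cong₂; subst; module ≡-Reasoning)
open import Relation.Nullary using (Dec; yes; no; does; ¬_; ¬?; _×-dec_; contradiction)
open import Relation.Nullary.Decidable using (decidable-stable; ¬¬-excluded-middle)
open import Relation.Nullary.Negation using (¬¬-Monad; ¬¬-map)
open import Relation.Unary using (Pred; Decidable)

open import Algebra.Properties.Semiring.Sum (CommutativeRing.semiring ℚP.+-*-commutativeRing)
  using (sum; sum-syntax; sum-cong-≗; sum-remove; sum-replicate-zero; ∑-distrib-+)
open import Algebra.Properties.CommutativeSemigroup
  (CommutativeMonoid.commutativeSemigroup ℚP.+-0-commutativeMonoid)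
  using (interchange)
open import Algebra.Properties.Group ℚP.+-0-group using (∙-cancelˡ)

*-monoˡ-≤-≥0 : ∀ {r p q} → 0ℚ ≤ r → p ≤ q → r * p ≤ r * q
*-monoˡ-≤-≥0 {r} 0≤r = ℚP.*-monoˡ-≤-nonNeg r {{nonNegative 0≤r}}

*-monoʳ-≤-≥0 : ∀ {r p q} → 0ℚ ≤ r → p ≤ q → p * r ≤ q * r
*-monoʳ-≤-≥0 {r} 0≤r = ℚP.*-monoʳ-≤-nonNeg r {{nonNegative 0≤r}}

*-≥0 : ∀ {p q} → 0ℚ ≤ p → 0ℚ ≤ q → 0ℚ ≤ p * q
*-≥0 {p} 0≤p 0≤q = ℚP.≤-trans (ℚP.≤-reflexive (sym (ℚP.*-zeroʳ p))) (*-monoˡ-≤-≥0 0≤p 0≤q)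

nℚ-suc : ∀ k → nℚ (suc k) ≡ 1ℚ + nℚ k
nℚ-suc k = ℚP.toℚᵘ-injective (begin
  toℚᵘ (nℚ (suc k))                ≈⟨ ℚP.toℚᵘ-fromℚᵘ (ℚᵘ.mkℚᵘ (+ suc k) 0) ⟩
  ℚᵘ.mkℚᵘ (+ suc k) 0              ≈⟨ ℚᵘ.*≡* (cong (λ z → (+ 1 ℤ.+ z) ℤ.* + 1) k≡k*1) ⟩
  ℚᵘ.1ℚᵘ ℚᵘ.+ ℚᵘ.mkℚᵘ (+ k) 0      ≈⟨ ℚᵘP.+-congʳ ℚᵘ.1ℚᵘ (ℚP.toℚᵘ-fromℚᵘ (ℚᵘ.mkℚᵘ (+ k) 0)) ⟨
  toℚᵘ 1ℚ ℚᵘ.+ toℚᵘ (nℚ k)          ≈⟨ ℚP.toℚᵘ-homo-+ 1ℚ (nℚ k) ⟨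
  toℚᵘ (1ℚ + nℚ k)                 ∎)
  where
  open ℚᵘP.≃-Reasoning
  k≡k*1 : + k ≡ + k ℤ.* + 1
  k≡k*1 = sym (ℤP.*-identityʳ (+ k))

0≤nℚ : ∀ k → 0ℚ ≤ nℚ k
0≤nℚ k = ℚP.nonNegative⁻¹ (nℚ k) {{ℚP.normalize-nonNeg k 1}}

1≤nℚ : ∀ {k} → Fin k → 1ℚ ≤ nℚ k
1≤nℚ {suc k} _ = begin
  1ℚ        ≡⟨ ℚP.+-identityʳ 1ℚ ⟨
  1ℚ + 0ℚ   ≤⟨ ℚP.+-monoʳ-≤ 1ℚ (0≤nℚ k) ⟩
  1ℚ + nℚ k ≡⟨ nℚ-suc k ⟨
  nℚ (suc k) ∎
  where open ℚP.≤-Reasoning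

private
  variable
    A : Set
    P Q : Set

∑-mono-≤ : ∀ {n} {f g : Fin n → ℚ} → (∀ i → f i ≤ g i) → ∑[ i < n ] f i ≤ ∑[ i < n ] g i
∑-mono-≤ {zero}  _   = ℚP.≤-refl
∑-mono-≤ {suc n} f≤g = ℚP.+-mono-≤ (f≤g zero) (∑-mono-≤ (f≤g ∘ suc))

∑-≥0 : ∀ {n} {f : Fin n → ℚ} → (∀ i → 0ℚ ≤ f i) → 0ℚ ≤ ∑[ i < n ] f i
∑-≥0 {n} {f} 0≤f = subst (_≤ sum f) (sum-replicate-zero n) (∑-mono-≤ 0≤f)

≤-∑ : ∀ {n} (f : Fin n → ℚ) t → (∀ i → 0ℚ ≤ f i) → f t ≤ ∑[ i < n ] f i
≤-∑ {suc n} f t 0≤f = begin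
  f t                 ≡⟨ ℚP.+-identityʳ (f t) ⟨
  f t + 0ℚ            ≤⟨ ℚP.+-monoʳ-≤ (f t) (∑-≥0 (0≤f ∘ punchIn t)) ⟩
  f t + ∑[ i < n ] f (punchIn t i) ≡⟨ sum-remove f ⟨
  ∑[ i < suc n ] f i  ∎
  where open ℚP.≤-Reasoning

∑-δ : ∀ {n} (f : Fin n → ℚ) t → (∀ i → i ≢ t → f i ≡ 0ℚ) → ∑[ i < n ] f i ≡ f t
∑-δ {suc n} f t off = begin
  ∑[ i < suc n ] f i               ≡⟨ sum-remove f ⟩
  f t + ∑[ i < n ] f (punchIn t i) ≡⟨ cong (λ s → f t + s) (sum-cong-≗ off-t) ⟩
  f t + ∑[ i < n ] 0ℚ              ≡⟨ cong (λ s → f t + s) (sum-replicate-zero n) ⟩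
  f t + 0ℚ                         ≡⟨ ℚP.+-identityʳ (f t) ⟩
  f t                              ∎
  where
  open ≡-Reasoning
  off-t : ∀ i → f (punchIn t i) ≡ 0ℚ
  off-t i = off (punchIn t i) (punchInᵢ≢i t i)

∑-const : ∀ n c → ∑[ i < n ] c ≡ nℚ n * c
∑-const zero    c = sym (ℚP.*-zeroˡ c)
∑-const (suc n) c = begin
  c + ∑[ i < n ] c     ≡⟨ cong₂ _+_ (sym (ℚP.*-identityˡ c)) (∑-const n c) ⟩
  1ℚ * c + nℚ n * c    ≡⟨ ℚP.*-distribʳ-+ c 1ℚ (nℚ n) ⟨
  (1ℚ + nℚ n) * c      ≡⟨ cong (_* c) (nℚ-suc n) ⟨
  nℚ (suc n) * c       ∎
  where open ≡-Reasoning

∑ₗ : List A → (A → ℚ) → ℚ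
∑ₗ xs f = sumℚ (map f xs)

infixl 10 ∑ₗ
syntax ∑ₗ xs (λ x → t) = ∑[ x ∈ xs ] t

∑ₗ-cong : ∀ (xs : List A) {f g : A → ℚ} → (∀ x → f x ≡ g x) →
          ∑[ x ∈ xs ] f x ≡ ∑[ x ∈ xs ] g x
∑ₗ-cong []       _   = refl
∑ₗ-cong (x ∷ xs) f≗g = cong₂ _+_ (f≗g x) (∑ₗ-cong xs f≗g)

∑ₗ-mono-≤ : ∀ (xs : List A) {f g : A → ℚ} → (∀ {x} → x ∈ xs → f x ≤ g x) →
            ∑[ x ∈ xs ] f x ≤ ∑[ x ∈ xs ] g x
∑ₗ-mono-≤ []       _   = ℚP.≤-refl
∑ₗ-mono-≤ (x ∷ xs) f≤g = ℚP.+-mono-≤ (f≤g (here refl)) (∑ₗ-mono-≤ xs (f≤g ∘ there))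

∑ₗ-zero : ∀ (xs : List A) → ∑[ x ∈ xs ] 0ℚ ≡ 0ℚ
∑ₗ-zero []       = refl
∑ₗ-zero (x ∷ xs) = trans (ℚP.+-identityˡ _) (∑ₗ-zero xs)

∑ₗ-distrib-+ : ∀ (xs : List A) (f g : A → ℚ) →
               ∑[ x ∈ xs ] (f x + g x) ≡ ∑[ x ∈ xs ] f x + ∑[ x ∈ xs ] g x
∑ₗ-distrib-+ []       f g = refl
∑ₗ-distrib-+ (x ∷ xs) f g =
  trans (cong (λ s → f x + g x + s) (∑ₗ-distrib-+ xs f g)) (interchange (f x) (g x) _ _)

*-distribˡ-∑ₗ : ∀ c (xs : List A) (f : A → ℚ) → c * ∑[ x ∈ xs ] f x ≡ ∑[ x ∈ xs ] (c * f x)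
*-distribˡ-∑ₗ c []       f = ℚP.*-zeroʳ c
*-distribˡ-∑ₗ c (x ∷ xs) f =
  trans (ℚP.*-distribˡ-+ c (f x) _) (cong (λ s → c * f x + s) (*-distribˡ-∑ₗ c xs f))

∑ₗ-∑-comm : ∀ {n} (xs : List A) (F : A → Fin n → ℚ) →
            ∑[ x ∈ xs ] ∑[ i < n ] F x i ≡ ∑[ i < n ] ∑[ x ∈ xs ] F x i
∑ₗ-∑-comm {n = n} []       F = sym (sum-replicate-zero n)
∑ₗ-∑-comm         (x ∷ xs) F =
  trans (cong (λ s → sum (F x) + s) (∑ₗ-∑-comm xs F)) (sym (∑-distrib-+ (F x) _))

-- The Iverson bracket is opaque so that unification can recover P? from [ P? ]· a.
opaque
  infixr 11 [_]·_

  [_]·_ : Dec P → ℚ → ℚ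
  [ P? ]· a = if does P? then a else 0ℚ

  []·-yes : ∀ (P? : Dec P) {a} → P → [ P? ]· a ≡ a
  []·-yes (yes _) _ = refl
  []·-yes (no ¬p) p = contradiction p ¬p

  []·-no : ∀ (P? : Dec P) {a} → ¬ P → [ P? ]· a ≡ 0ℚ
  []·-no (yes p) ¬p = contradiction p ¬p
  []·-no (no _)  _  = refl

  []·-zero : ∀ (P? : Dec P) → [ P? ]· 0ℚ ≡ 0ℚ
  []·-zero (yes _) = refl
  []·-zero (no _)  = refl

  []·-≥0 : ∀ (P? : Dec P) {a} → 0ℚ ≤ a → 0ℚ ≤ [ P? ]· a
  []·-≥0 (yes _) 0≤a = 0≤a
  []·-≥0 (no _)  _   = ℚP.≤-refl

  *-distribˡ-[]· : ∀ (P? : Dec P) c a → c * [ P? ]· a ≡ [ P? ]· (c * a)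
  *-distribˡ-[]· (yes _) c a = refl
  *-distribˡ-[]· (no _)  c a = ℚP.*-zeroʳ c

  []·-split : ∀ (P? : Dec P) (Q? : Dec Q) a →
              [ P? ]· a ≡ [ P? ×-dec Q? ]· a + [ P? ×-dec ¬? Q? ]· a
  []·-split (yes _) (yes _) a = sym (ℚP.+-identityʳ a)
  []·-split (yes _) (no _)  a = sym (ℚP.+-identityˡ a)
  []·-split (no _)  _       a = refl

  []·-×-comm : ∀ (P? : Dec P) (Q? : Dec Q) a → [ P? ×-dec Q? ]· a ≡ [ Q? ×-dec P? ]· a
  []·-×-comm (yes _) (yes _) a = refl
  []·-×-comm (yes _) (no _)  a = refl
  []·-×-comm (no _)  (yes _) a = refl
  []·-×-comm (no _)  (no _)  a = refl

  []·-mono-≤ : ∀ {P? : Dec P} {Q? : Dec Q} {a b} →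
               (P → Q) → (P → a ≤ b) → 0ℚ ≤ b → [ P? ]· a ≤ [ Q? ]· b
  []·-mono-≤ {P? = yes p} {yes _} _   a≤b _   = a≤b p
  []·-mono-≤ {P? = yes p} {no ¬q} P⇒Q _   _   = contradiction (P⇒Q p) ¬q
  []·-mono-≤ {P? = no _}  {Q?}    _   _   0≤b = []·-≥0 Q? 0≤b

  []·-distrib-∑ₗ : ∀ (P? : Dec P) (xs : List A) (f : A → ℚ) →
                   [ P? ]· (∑[ x ∈ xs ] f x) ≡ ∑[ x ∈ xs ] [ P? ]· f x
  []·-distrib-∑ₗ (yes _) xs f = refl
  []·-distrib-∑ₗ (no _)  xs f = sym (∑ₗ-zero xs)

  ∑ₗ-filter : ∀ {P : Pred A _} (P? : Decidable P) (xs : List A) (f : A → ℚ) →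
              ∑[ x ∈ filter P? xs ] f x ≡ ∑[ x ∈ xs ] [ P? x ]· f x
  ∑ₗ-filter P? []       f = refl
  ∑ₗ-filter P? (x ∷ xs) f with does (P? x)
  ... | true  = cong (λ s → f x + s) (∑ₗ-filter P? xs f)
  ... | false = trans (∑ₗ-filter P? xs f) (sym (ℚP.+-identityˡ _))

*-distribˡ-∑ₗ-[]· : ∀ {P : Pred A _} (P? : Decidable P) c (xs : List A) (f : A → ℚ) →
                    c * ∑[ x ∈ xs ] [ P? x ]· f x ≡ ∑[ x ∈ xs ] [ P? x ]· (c * f x)
*-distribˡ-∑ₗ-[]· P? c xs f =
  trans (*-distribˡ-∑ₗ c xs _) (∑ₗ-cong xs (λ x → *-distribˡ-[]· (P? x) c (f x)))

∑-fibres : ∀ {n} {S : Pred (Fin n) _} (S? : Decidable S) (end : A → Fin n)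
           (xs : List A) (f : A → ℚ) →
           ∑[ v < n ] [ S? v ]· (∑[ x ∈ filter (λ x → end x ≟ v) xs ] f x)
             ≡ ∑[ x ∈ xs ] [ S? (end x) ]· f x
∑-fibres {n = n} S? end xs f = begin
  ∑[ v < n ] [ S? v ]· (∑[ x ∈ filter (λ x → end x ≟ v) xs ] f x)
    ≡⟨ sum-cong-≗ (λ v → cong ([ S? v ]·_) (∑ₗ-filter (λ x → end x ≟ v) xs f)) ⟩
  ∑[ v < n ] [ S? v ]· (∑[ x ∈ xs ] [ end x ≟ v ]· f x)
    ≡⟨ sum-cong-≗ (λ v → []·-distrib-∑ₗ (S? v) xs _) ⟩
  ∑[ v < n ] ∑[ x ∈ xs ] [ S? v ]· [ end x ≟ v ]· f x
    ≡⟨ ∑ₗ-∑-comm xs (λ x v → [ S? v ]· [ end x ≟ v ]· f x) ⟨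
  ∑[ x ∈ xs ] ∑[ v < n ] [ S? v ]· [ end x ≟ v ]· f x
    ≡⟨ ∑ₗ-cong xs (λ x → ∑-δ _ (end x) (off-fibre x)) ⟩
  ∑[ x ∈ xs ] [ S? (end x) ]· [ end x ≟ end x ]· f x
    ≡⟨ ∑ₗ-cong xs (λ x → cong ([ S? (end x) ]·_) ([]·-yes (end x ≟ end x) refl)) ⟩
  ∑[ x ∈ xs ] [ S? (end x) ]· f x ∎
  where
  open ≡-Reasoning
  off-fibre : ∀ x v → v ≢ end x → [ S? v ]· [ end x ≟ v ]· f x ≡ 0ℚ
  off-fibre x v v≢end =
    trans (cong ([ S? v ]·_) ([]·-no (end x ≟ v) (v≢end ∘ sym))) ([]·-zero (S? v))

module _ (G : Graph) where

  weightInto : {S : Pred (Fin (n G)) _} → Decidable S → ℚ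
  weightInto S? = ∑[ e ∈ arcs G ] [ S? (tgt e) ×-dec ¬? (S? (src e)) ]· w e

  weightOutOf : {S : Pred (Fin (n G)) _} → Decidable S → ℚ
  weightOutOf S? = ∑[ e ∈ arcs G ] [ S? (src e) ×-dec ¬? (S? (tgt e)) ]· w e

  weightInto≡weightOutOf : Eulerian G → {S : Pred (Fin (n G)) _} (S? : Decidable S) →
                           weightInto S? ≡ weightOutOf S?
  weightInto≡weightOutOf eulerian S? = ∙-cancelˡ internal _ _ (begin
    internal + weightInto S?                   ≡⟨ split tgt src ⟨
    ∑[ e ∈ arcs G ] [ S? (tgt e) ]· w e        ≡⟨ ∑-fibres S? tgt (arcs G) w ⟨
    ∑[ v < n G ] [ S? v ]· inWeight G v        ≡⟨ sum-cong-≗ (λ v → cong ([ S? v ]·_) (eulerian v)) ⟩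
    ∑[ v < n G ] [ S? v ]· outWeight G v       ≡⟨ ∑-fibres S? src (arcs G) w ⟩
    ∑[ e ∈ arcs G ] [ S? (src e) ]· w e        ≡⟨ split src tgt ⟩
    internal′ + weightOutOf S?                 ≡⟨ cong (_+ weightOutOf S?) internal′≡internal ⟩
    internal + weightOutOf S?                  ∎)
    where
    open ≡-Reasoning
    internal internal′ : ℚ
    internal  = ∑[ e ∈ arcs G ] [ S? (tgt e) ×-dec S? (src e) ]· w e
    internal′ = ∑[ e ∈ arcs G ] [ S? (src e) ×-dec S? (tgt e) ]· w e
    internal′≡internal : internal′ ≡ internal
    internal′≡internal = ∑ₗ-cong (arcs G) (λ e → []·-×-comm (S? (src e)) (S? (tgt e)) (w e))
    split : (end end′ : Arc (n G) → Fin (n G)) →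
            ∑[ e ∈ arcs G ] [ S? (end e) ]· w e
              ≡ ∑[ e ∈ arcs G ] [ S? (end e) ×-dec S? (end′ e) ]· w e
                + ∑[ e ∈ arcs G ] [ S? (end e) ×-dec ¬? (S? (end′ e)) ]· w e
    split end end′ = trans (∑ₗ-cong (arcs G) (λ e → []·-split (S? (end e)) (S? (end′ e)) (w e)))
                           (∑ₗ-distrib-+ (arcs G) _ _)

*-cancelˡ-≤-nℚ : ∀ {k} (es : List (Arc k)) {f g : Arc k → ℚ} →
                 nℚ k * ∑[ e ∈ es ] f e ≤ nℚ k * ∑[ e ∈ es ] g e →
                 ∑[ e ∈ es ] f e ≤ ∑[ e ∈ es ] g e
*-cancelˡ-≤-nℚ         []      _ = ℚP.≤-refl
*-cancelˡ-≤-nℚ {suc k} (_ ∷ _)   = ℚP.*-cancelˡ-≤-pos (nℚ (suc k)) {{ℚP.normalize-pos (suc k) 1}}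

module _ {G : Graph} {x : ℚ} where

  ShortReach-snoc : ∀ {u e} → ShortReach G x u (src e) → e ∈ arcs G → l e ≤ x →
                    ShortReach G x u (tgt e)
  ShortReach-snoc here                        e∈G short = step _ e∈G short refl here
  ShortReach-snoc (step e′ e′∈G short′ refl r) e∈G short =
    step e′ e′∈G short′ refl (ShortReach-snoc r e∈G short)

  short-arc-reversible⇒Merged : ∀ {e} → e ∈ arcs G → l e ≤ x →
                                ShortReach G x (tgt e) (src e) → Merged G x (src e) (tgt e)
  short-arc-reversible⇒Merged e∈G short back = step _ e∈G short refl here , back

longWeight : Graph → ℚ → ℚ
longWeight G x = ∑[ e ∈ arcs G ] [ x ℚP.<? l e ]· w e

module _ (G : Graph) (x : ℚ) (reach? : ∀ u v → Dec (ShortReach G x u v))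
         (0≤w : ∀ {e} → e ∈ arcs G → 0ℚ ≤ w e) where

  weightOutOf-reach≤longWeight : ∀ u → weightOutOf G (reach? u) ≤ longWeight G x
  weightOutOf-reach≤longWeight u =
    ∑ₗ-mono-≤ (arcs G) (λ e∈G → []·-mono-≤ (leaving⇒long e∈G) (λ _ → ℚP.≤-refl) (0≤w e∈G))
    where
    leaving⇒long : ∀ {e} → e ∈ arcs G →
                   ShortReach G x u (src e) × ¬ ShortReach G x u (tgt e) → x < l e
    leaving⇒long e∈G (into , ¬out) = ℚP.≰⇒> (λ short → ¬out (ShortReach-snoc into e∈G short))

  shortIrreversibleWeight≤ : Eulerian G →
    ∑[ e ∈ arcs G ] [ l e ℚP.≤? x ×-dec ¬? (reach? (tgt e) (src e)) ]· w e
      ≤ nℚ (n G) * longWeight G x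
  shortIrreversibleWeight≤ eulerian = begin
    ∑[ e ∈ arcs G ] [ l e ℚP.≤? x ×-dec ¬? (reach? (tgt e) (src e)) ]· w e
      ≤⟨ ∑ₗ-mono-≤ (arcs G) entersReachOfTarget ⟩
    ∑[ e ∈ arcs G ] ∑[ v < n G ] crossing e v
      ≡⟨ ∑ₗ-∑-comm (arcs G) crossing ⟩
    ∑[ v < n G ] weightInto G (reach? v)
      ≡⟨ sum-cong-≗ (λ v → weightInto≡weightOutOf G eulerian (reach? v)) ⟩
    ∑[ v < n G ] weightOutOf G (reach? v)
      ≤⟨ ∑-mono-≤ weightOutOf-reach≤longWeight ⟩
    ∑[ v < n G ] longWeight G x
      ≡⟨ ∑-const (n G) (longWeight G x) ⟩
    nℚ (n G) * longWeight G x ∎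
    where
    open ℚP.≤-Reasoning
    crossing : Arc (n G) → Fin (n G) → ℚ
    crossing e v = [ reach? v (tgt e) ×-dec ¬? (reach? v (src e)) ]· w e
    entersReachOfTarget : ∀ {e} → e ∈ arcs G →
      [ l e ℚP.≤? x ×-dec ¬? (reach? (tgt e) (src e)) ]· w e ≤ ∑[ v < n G ] crossing e v
    entersReachOfTarget {e} e∈G = ℚP.≤-trans
      ([]·-mono-≤ (λ (_ , irreversible) → here , irreversible) (λ _ → ℚP.≤-refl) (0≤w e∈G))
      (≤-∑ (crossing e) (tgt e) (λ v → []·-≥0 _ (0≤w e∈G)))

module CollapseBound (G : Graph) (eulerian : Eulerian G) (positive : PositiveWL G)
                     (xL xR : ℚ) (0<xL : 0ℚ < xL) (xL<xR : xL < xR)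
                     (merged? : ∀ u v → Dec (Merged G xL u v))
                     (reach? : ∀ u v → Dec (ShortReach G xL u v)) where

  private
    N = n G
    E = arcs G

  l′ : Arc N → ℚ
  l′ e = l e ⊓ xR

  survives? : (e : Arc N) → Dec (¬ Merged G xL (src e) (tgt e))
  survives? e = ¬? (merged? (src e) (tgt e))

  counted? : (e : Arc N) → Dec (xL < l e * nℚ N)
  counted? e = xL ℚP.<? (l e * nℚ N)

  0≤w : ∀ {e} → e ∈ E → 0ℚ ≤ w e
  0≤w e∈E = ℚP.<⇒≤ (proj₁ (positive e∈E))

  0≤l′ : ∀ {e} → e ∈ E → 0ℚ ≤ l′ e
  0≤l′ e∈E = ℚP.⊓-glb (ℚP.<⇒≤ (proj₂ (positive e∈E))) (ℚP.<⇒≤ (ℚP.<-trans 0<xL xL<xR))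

  l≤l*N : ∀ {e} → e ∈ E → l e ≤ l e * nℚ N
  l≤l*N {e} e∈E = begin
    l e          ≡⟨ ℚP.*-identityʳ (l e) ⟨
    l e * 1ℚ     ≤⟨ *-monoˡ-≤-≥0 (ℚP.<⇒≤ (proj₂ (positive e∈E))) (1≤nℚ (src e)) ⟩
    l e * nℚ N   ∎
    where open ℚP.≤-Reasoning

  rhs : ℚ
  rhs = ∑[ e ∈ E ] [ counted? e ]· (w e * l′ e)

  countedPart uncountedPart : ℚ
  countedPart   = ∑[ e ∈ E ] [ survives? e ×-dec counted? e ]· (l′ e * w e)
  uncountedPart = ∑[ e ∈ E ] [ survives? e ×-dec ¬? (counted? e) ]· (l′ e * w e)

  vol-collapsed≡ : vol (collapsedArcs G xL xR merged?) ≡ countedPart + uncountedPart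
  vol-collapsed≡ = begin
    vol (collapsedArcs G xL xR merged?)
      ≡⟨ cong sumℚ (map-∘ (filter survives? E)) ⟨
    ∑[ e ∈ filter survives? E ] (l′ e * w e)
      ≡⟨ ∑ₗ-filter survives? E _ ⟩
    ∑[ e ∈ E ] [ survives? e ]· (l′ e * w e)
      ≡⟨ ∑ₗ-cong E (λ e → []·-split (survives? e) (counted? e) _) ⟩
    ∑[ e ∈ E ] ([ survives? e ×-dec counted? e ]· (l′ e * w e)
                  + [ survives? e ×-dec ¬? (counted? e) ]· (l′ e * w e))
      ≡⟨ ∑ₗ-distrib-+ E _ _ ⟩
    countedPart + uncountedPart ∎
    where open ≡-Reasoning

  countedPart≤rhs : countedPart ≤ rhs
  countedPart≤rhs = ∑ₗ-mono-≤ E (λ {e} e∈E →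
    []·-mono-≤ proj₂ (λ _ → ℚP.≤-reflexive (ℚP.*-comm (l′ e) (w e))) (*-≥0 (0≤w e∈E) (0≤l′ e∈E)))

  uncountedWeight : ℚ
  uncountedWeight = ∑[ e ∈ E ] [ survives? e ×-dec ¬? (counted? e) ]· w e

  N*uncountedPart≤xL*uncountedWeight : nℚ N * uncountedPart ≤ xL * uncountedWeight
  N*uncountedPart≤xL*uncountedWeight = begin
    nℚ N * uncountedPart
      ≡⟨ *-distribˡ-∑ₗ-[]· (λ e → survives? e ×-dec ¬? (counted? e)) (nℚ N) E _ ⟩
    ∑[ e ∈ E ] [ survives? e ×-dec ¬? (counted? e) ]· (nℚ N * (l′ e * w e))
      ≤⟨ ∑ₗ-mono-≤ E (λ e∈E →
           []·-mono-≤ id (uncounted-arc e∈E ∘ proj₂) (*-≥0 (ℚP.<⇒≤ 0<xL) (0≤w e∈E))) ⟩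
    ∑[ e ∈ E ] [ survives? e ×-dec ¬? (counted? e) ]· (xL * w e)
      ≡⟨ *-distribˡ-∑ₗ-[]· (λ e → survives? e ×-dec ¬? (counted? e)) xL E w ⟨
    xL * uncountedWeight ∎
    where
    open ℚP.≤-Reasoning
    uncounted-arc : ∀ {e} → e ∈ E → ¬ xL < l e * nℚ N → nℚ N * (l′ e * w e) ≤ xL * w e
    uncounted-arc {e} e∈E ¬counted = begin
      nℚ N * (l′ e * w e) ≡⟨ ℚP.*-assoc (nℚ N) (l′ e) (w e) ⟨
      nℚ N * l′ e * w e   ≡⟨ cong (_* w e) (ℚP.*-comm (nℚ N) (l′ e)) ⟩
      l′ e * nℚ N * w e   ≤⟨ *-monoʳ-≤-≥0 (0≤w e∈E) (*-monoʳ-≤-≥0 (0≤nℚ N) (ℚP.p⊓q≤p (l e) xR)) ⟩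
      l e * nℚ N * w e    ≤⟨ *-monoʳ-≤-≥0 (0≤w e∈E) (ℚP.≮⇒≥ ¬counted) ⟩
      xL * w e            ∎

  uncountedWeight≤shortIrreversibleWeight :
    uncountedWeight ≤ ∑[ e ∈ E ] [ l e ℚP.≤? xL ×-dec ¬? (reach? (tgt e) (src e)) ]· w e
  uncountedWeight≤shortIrreversibleWeight = ∑ₗ-mono-≤ E (λ e∈E →
    []·-mono-≤ (uncounted⇒shortIrreversible e∈E) (λ _ → ℚP.≤-refl) (0≤w e∈E))
    where
    uncounted⇒shortIrreversible : ∀ {e} → e ∈ E →
      ¬ Merged G xL (src e) (tgt e) × ¬ xL < l e * nℚ N →
      l e ≤ xL × ¬ ShortReach G xL (tgt e) (src e)
    uncounted⇒shortIrreversible e∈E (unmerged , ¬counted) =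
      short , unmerged ∘ short-arc-reversible⇒Merged e∈E short
      where short = ℚP.≤-trans (l≤l*N e∈E) (ℚP.≮⇒≥ ¬counted)

  xL*longWeight≤rhs : xL * longWeight G xL ≤ rhs
  xL*longWeight≤rhs = begin
    xL * longWeight G xL
      ≡⟨ *-distribˡ-∑ₗ-[]· (λ e → xL ℚP.<? l e) xL E w ⟩
    ∑[ e ∈ E ] [ xL ℚP.<? l e ]· (xL * w e)
      ≤⟨ ∑ₗ-mono-≤ E (λ e∈E →
           []·-mono-≤ (long⇒counted e∈E) (long-arc e∈E) (*-≥0 (0≤w e∈E) (0≤l′ e∈E))) ⟩
    rhs ∎
    where
    open ℚP.≤-Reasoning
    long⇒counted : ∀ {e} → e ∈ E → xL < l e → xL < l e * nℚ N
    long⇒counted e∈E long = ℚP.<-≤-trans long (l≤l*N e∈E)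
    long-arc : ∀ {e} → e ∈ E → xL < l e → xL * w e ≤ w e * l′ e
    long-arc {e} e∈E long = begin
      xL * w e   ≡⟨ ℚP.*-comm xL (w e) ⟩
      w e * xL   ≤⟨ *-monoˡ-≤-≥0 (0≤w e∈E) (ℚP.⊓-glb (ℚP.<⇒≤ long) (ℚP.<⇒≤ xL<xR)) ⟩
      w e * l′ e ∎

  uncountedPart≤rhs : uncountedPart ≤ rhs
  uncountedPart≤rhs = *-cancelˡ-≤-nℚ E (begin
    nℚ N * uncountedPart          ≤⟨ N*uncountedPart≤xL*uncountedWeight ⟩
    xL * uncountedWeight          ≤⟨ *-monoˡ-≤-≥0 (ℚP.<⇒≤ 0<xL) uncountedWeight≤N*longWeight ⟩
    xL * (nℚ N * longWeight G xL) ≡⟨ ℚP.*-assoc xL (nℚ N) _ ⟨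
    xL * nℚ N * longWeight G xL   ≡⟨ cong (_* longWeight G xL) (ℚP.*-comm xL (nℚ N)) ⟩
    nℚ N * xL * longWeight G xL   ≡⟨ ℚP.*-assoc (nℚ N) xL _ ⟩
    nℚ N * (xL * longWeight G xL) ≤⟨ *-monoˡ-≤-≥0 (0≤nℚ N) xL*longWeight≤rhs ⟩
    nℚ N * rhs                    ∎)
    where
    open ℚP.≤-Reasoning
    uncountedWeight≤N*longWeight : uncountedWeight ≤ nℚ N * longWeight G xL
    uncountedWeight≤N*longWeight = ℚP.≤-trans uncountedWeight≤shortIrreversibleWeight
      (shortIrreversibleWeight≤ G xL reach? 0≤w eulerian)

  vol-collapsed≤ : vol (collapsedArcs G xL xR merged?) ≤ (+ 2 / 1) * rhsSum G xL xR
  vol-collapsed≤ = begin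
    vol (collapsedArcs G xL xR merged?) ≡⟨ vol-collapsed≡ ⟩
    countedPart + uncountedPart         ≤⟨ ℚP.+-mono-≤ countedPart≤rhs uncountedPart≤rhs ⟩
    rhs + rhs                           ≡⟨ cong₂ _+_ (ℚP.*-identityˡ rhs) (ℚP.*-identityˡ rhs) ⟨
    1ℚ * rhs + 1ℚ * rhs                 ≡⟨ ℚP.*-distribʳ-+ rhs 1ℚ 1ℚ ⟨
    (+ 2 / 1) * rhs                     ≡⟨ cong ((+ 2 / 1) *_) (∑ₗ-filter counted? E _) ⟨
    (+ 2 / 1) * rhsSum G xL xR          ∎
    where open ℚP.≤-Reasoning

¬¬-decidable₂ : ∀ {k} (R : Fin k → Fin k → Set) → ¬ ¬ (∀ u v → Dec (R u v))
¬¬-decidable₂ R = sequence ¬¬-applicative λ u → sequence ¬¬-applicative λ v → ¬¬-excluded-middle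
  where ¬¬-applicative = RawMonad.rawApplicative ¬¬-Monad

mainTheorem14 : (G : Graph) → Eulerian G → PositiveWL G →
    (xL xR : ℚ) → 0ℚ < xL → xL < xR →
    (dec : (u v : Fin (n G)) → Dec (Merged G xL u v)) →
    vol (collapsedArcs G xL xR dec) ≤ (+ 2 / 1) * rhsSum G xL xR
mainTheorem14 G eulerian positive xL xR 0<xL xL<xR dec =
  -- No decision procedure for short reachability is needed: the goal is a
  -- decidable inequality, so decidability up to double negation suffices.
  decidable-stable (_ ℚP.≤? _)
    (¬¬-map (CollapseBound.vol-collapsed≤ G eulerian positive xL xR 0<xL xL<xR dec)
            (¬¬-decidable₂ (ShortReach G xL)))
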